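{- If a graph $H$ is $AB$-constructible, then $H\not\to\mathrm{TT}_3$, i.e., $H$ admits an orientation containing no transitive triangle.
   Context: $\mathrm{TT}_3$ is the transitive triangle. For graphs $G,F$, $\mathcal C_F(G)$ is the graph whose vertices are the copies of $F$ in $G$, two distinct copies adjacent if they share an edge; an $F$-component of $G$ is the union of all copies of $F$ in a connected component of $\mathcal C_F(G)$. A construction sequence of an $F$-component $C$ is a sequence $H_1\subseteq H_2\subseteq\dots\subseteq H_t=C$ where $H_1$ is a copy of $F$ in $C$ and, for each $i\in[t-1]$, there is a copy $F'$ of $F$ with $F'\not\subseteq H_i$, $E(F')\cap E(H_i)\ne\emptyset$ and $H_{i+1}=H_i\cup F'$. For $F=K_3$, each step $i\in[t-1]$ is of one of three types: (A) two edges of $H_{i+1}$ are not in $H_i$ and one vertex of $H_{i+1}$ is not in $H_i$; (B) two edges of $H_{i+1}$ are not in $H_i$ and $V(H_{i+1})=V(H_i)$; (C) exactly one edge of $H_{i+1}$ is not in $H_i$ and $V(H_{i+1})=V(H_i)$. A graph $H$ is $AB$-constructible if no construction sequence of any $K_3$-component of $H$ contains a step of type (C). -}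

module Defs where

open import Data.Nat using (ℕ; zero; suc; _≤_; _<_)
open import Data.Fin using (Fin)
open import Data.Bool using (Bool; true; false; not)
open import Data.Product using (Σ; Σ-syntax; ∃; ∃-syntax; _×_; _,_)
open import Data.Sum using (_⊎_)
open import Relation.Nullary using (¬_)
open import Relation.Binary.PropositionalEquality using (_≡_; _≢_)
open import Relation.Binary.Construct.Closure.ReflexiveTransitive using (Star)

record Graph (n : ℕ) : Set where
  field
    adj    : Fin n → Fin n → Bool
    sym    : ∀ u v → adj u v ≡ adj v u
    irrefl : ∀ u → adj u u ≡ false

module _ {n : ℕ} (G : Graph n) where
  open Graph G

  record Triangle : Set where
    constructor tri
    field
      a b c : Fin n
      ab : adj a b ≡ true
      bc : adj b c ≡ true
      ac : adj a c ≡ true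

  VertIn : Triangle → Fin n → Set
  VertIn T x = x ≡ Triangle.a T ⊎ x ≡ Triangle.b T ⊎ x ≡ Triangle.c T

  EdgeIn : Triangle → Fin n → Fin n → Set
  EdgeIn T u v = u ≢ v × VertIn T u × VertIn T v

  SameCopy : Triangle → Triangle → Set
  SameCopy T T' = ∀ x → (VertIn T x → VertIn T' x) × (VertIn T' x → VertIn T x)

  CAdj : Triangle → Triangle → Set
  CAdj T T' = ¬ SameCopy T T' × (∃[ u ] ∃[ v ] (EdgeIn T u v × EdgeIn T' u v))

  SameComp : Triangle → Triangle → Set
  SameComp = Star CAdj

  -- the K₃-component of G determined by the copy T₀: the union of all copies
  -- in the connected component of T₀ in 𝒞_{K₃}(G)
  CompVert : Triangle → Fin n → Set
  CompVert T₀ x = Σ[ T ∈ Triangle ] (SameComp T₀ T × VertIn T x)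

  CompEdge : Triangle → Fin n → Fin n → Set
  CompEdge T₀ u v = Σ[ T ∈ Triangle ] (SameComp T₀ T × EdgeIn T u v)

  PrefVert : (ℕ → Triangle) → ℕ → Fin n → Set
  PrefVert T i x = Σ[ j ∈ ℕ ] (j ≤ i × VertIn (T j) x)

  PrefEdge : (ℕ → Triangle) → ℕ → Fin n → Fin n → Set
  PrefEdge T i u v = Σ[ j ∈ ℕ ] (j ≤ i × EdgeIn (T j) u v)

  SubPref : (ℕ → Triangle) → ℕ → Triangle → Set
  SubPref T i F' = (∀ x → VertIn F' x → PrefVert T i x)
                 × (∀ u v → EdgeIn F' u v → PrefEdge T i u v)

  -- A construction sequence H₁ ⊆ … ⊆ H_t of the K₃-component of T₀, with
  -- t = suc k, encoded by copies T 0, …, T k, where H_{i+1} (0-based: H_i)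
  -- is T 0 ∪ … ∪ T i; step i (i < k) goes from H_i to H_{i+1} = H_i ∪ T (suc i).
  record ConstructionSeq (T₀ : Triangle) : Set where
    field
      k     : ℕ
      T     : ℕ → Triangle
      start : SameComp T₀ (T 0)
      new   : ∀ i → i < k → ¬ SubPref T i (T (suc i))
      share : ∀ i → i < k → ∃[ u ] ∃[ v ] (EdgeIn (T (suc i)) u v × PrefEdge T i u v)
      finalV : ∀ x → (PrefVert T k x → CompVert T₀ x) × (CompVert T₀ x → PrefVert T k x)
      finalE : ∀ u v → (PrefEdge T k u v → CompEdge T₀ u v) × (CompEdge T₀ u v → PrefEdge T k u v)

  -- step i (from H_i to H_i ∪ F') is of type (C): exactly one edge of
  -- H_{i+1} is not in H_i, and V(H_{i+1}) = V(H_i)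
  StepC : (ℕ → Triangle) → ℕ → Triangle → Set
  StepC T i F' =
    (∀ x → VertIn F' x → PrefVert T i x)
    × (∃[ u ] ∃[ v ] (EdgeIn F' u v × ¬ PrefEdge T i u v
        × (∀ x y → EdgeIn F' x y → ¬ PrefEdge T i x y →
             (x ≡ u × y ≡ v) ⊎ (x ≡ v × y ≡ u))))

  ABConstructible : Set
  ABConstructible = ∀ (T₀ : Triangle) (S : ConstructionSeq T₀) →
    let open ConstructionSeq S in
    ∀ i → i < k → ¬ StepC T i (T (suc i))

  record Orientation : Set where
    field
      arc     : Fin n → Fin n → Bool
      arc-adj : ∀ u v → arc u v ≡ true → adj u v ≡ true
      arc-one : ∀ u v → adj u v ≡ true → arc u v ≡ not (arc v u)

  HasTT₃ : Orientation → Set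
  HasTT₃ o = ∃[ a ] ∃[ b ] ∃[ c ]
    (arc a b ≡ true × arc b c ≡ true × arc a c ≡ true)
    where open Orientation o

  NotArrowTT₃ : Set
  NotArrowTT₃ = Σ[ o ∈ Orientation ] ¬ HasTT₃ o

{-# OPTIONS --safe #-}
-- Orient the copies of K₃ cyclically, one K₃-component at a time and in the order of a
-- construction sequence.  AB-constructibility implies that no copy ever has two oriented
-- edges and one unoriented edge (adding it would be a step of type (C)).  Hence a copy with a new
-- edge has at most one oriented edge and can be oriented cyclically in agreement with it, and no
-- transitive triangle arises: it cannot lie in one cyclic copy, and if two of its edges were
-- oriented earlier then so was the third, giving an earlier transitive triangle.  Edges lying in
-- no copy of K₃ are oriented arbitrarily.
module Submission where

open import Data.Bool using (Bool; true; false; not)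
open import Data.Bool.Properties using () renaming (_≟_ to _≟ᵇ_)
open import Data.Empty using (⊥; ⊥-elim)
open import Data.Fin using (Fin) renaming (_≟_ to _≟ᶠ_; _<_ to _<ᶠ_; _<?_ to _<ᶠ?_)
open import Data.Fin.Properties using (any?; <-cmp) renaming (<-asym to <ᶠ-asym)
open import Data.List using (List; []; _∷_; _++_; length; filter; allFin; cartesianProduct)
open import Data.List.Membership.Propositional using (_∈_; find; lose)
open import Data.List.Membership.Propositional.Properties using (∈-allFin; ∈-cartesianProduct⁺; ∈-filter⁺)
open import Data.List.Properties using (length-++; ++-assoc; filter-notAll)
open import Data.List.Relation.Unary.Any using (Any; here; there) renaming (any? to anyˡ?; map to mapᴬ)
open import Data.List.Relation.Unary.Any.Properties using (++⁺ˡ; ++⁺ʳ; ++⁻)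
open import Data.Nat using (ℕ; zero; suc; _≤_; _<_; _<?_; z≤n; s≤s)
open import Data.Nat.Properties
  using (≤-refl; ≤-trans; n≤1+n; ≤-pred; <-≤-trans; <-irrefl; m≤n+m; m≤n⇒m≤1+n; m≤n⇒m<n∨m≡n)
open import Data.Product using (Σ; ∃; ∃₂; ∃-syntax; _×_; _,_; proj₁; proj₂; uncurry)
open import Data.Sum using (_⊎_; inj₁; inj₂; [_,_]′)
import Data.Sum as Sum
open import Function using (id; _∘_)
open import Relation.Binary.Core using (_⇒_)
open import Relation.Binary.Definitions using (Decidable; tri<; tri≈; tri>)
open import Relation.Binary.PropositionalEquality using (_≡_; _≢_; refl; sym; trans; subst)
open import Relation.Binary.Construct.Closure.ReflexiveTransitive using (ε; _◅_; _◅◅_)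
open import Relation.Nullary using (¬_; Dec; yes; no; does)
open import Relation.Nullary.Decidable using (_×-dec_; _⊎-dec_; ¬?; decidable-stable)
open import Relation.Unary.Properties using (∁?)
open import Defs

does-true : ∀ {A : Set} (a? : Dec A) → does a? ≡ true → A
does-true (yes a) _ = a

does-xor : ∀ {A B : Set} (a? : Dec A) (b? : Dec B) → (A → B → ⊥) → A ⊎ B → does a? ≡ not (does b?)
does-xor (yes a) (yes b) excl _        = ⊥-elim (excl a b)
does-xor (yes _) (no _)  _    _        = refl
does-xor (no _)  (yes _) _    _        = refl
does-xor (no ¬a) (no _)  _    (inj₁ a) = ⊥-elim (¬a a)
does-xor (no _)  (no ¬b) _    (inj₂ b) = ⊥-elim (¬b b)

Σ-≡true? : ∀ (β : Bool) {R : β ≡ true → Set} → (∀ p → Dec (R p)) → Dec (Σ (β ≡ true) R)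
Σ-≡true? true  R? with R? refl
... | yes r = yes (refl , r)
... | no ¬r = no λ { (refl , r) → ¬r r }
Σ-≡true? false _ = no λ ()

++-∷ : ∀ {A : Set} (R : List A) (t : A) (L : List A) →
       ∃₂ λ t′ L′ → R ++ t ∷ L ≡ t′ ∷ L′ × length L ≤ length L′
++-∷ []      t L = t , L , refl , ≤-refl
++-∷ (r ∷ R) t L = r , R ++ t ∷ L , refl ,
  subst (length L ≤_) (sym (length-++ R)) (≤-trans (n≤1+n (length L)) (m≤n+m _ (length R)))

module _ {n : ℕ} (G : Graph n) where
  open Graph G renaming (sym to adj-comm)
  module T = Triangle {G = G}

  Tri : Set
  Tri = Triangle G

  Vtx : Tri → Fin n → Set
  Vtx = VertIn G

  Edge : Tri → Fin n → Fin n → Set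
  Edge = EdgeIn G

  private
    variable
      t t′ Δ : Tri
      u v w x y z : Fin n
      L S B : List Tri

  adj⇒≢ : adj u v ≡ true → u ≢ v
  adj⇒≢ {u} uv refl with () ← trans (sym uv) (irrefl u)

  adj-sym : adj u v ≡ true → adj v u ≡ true
  adj-sym {u} {v} uv = trans (adj-comm v u) uv

  a≢b : ∀ t → T.a t ≢ T.b t
  a≢b t = adj⇒≢ (T.ab t)

  b≢c : ∀ t → T.b t ≢ T.c t
  b≢c t = adj⇒≢ (T.bc t)

  a≢c : ∀ t → T.a t ≢ T.c t
  a≢c t = adj⇒≢ (T.ac t)

  edge-ab : ∀ t → Edge t (T.a t) (T.b t)
  edge-ab t = a≢b t , inj₁ refl , inj₂ (inj₁ refl)

  edge-bc : ∀ t → Edge t (T.b t) (T.c t)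
  edge-bc t = b≢c t , inj₂ (inj₁ refl) , inj₂ (inj₂ refl)

  edge-ac : ∀ t → Edge t (T.a t) (T.c t)
  edge-ac t = a≢c t , inj₁ refl , inj₂ (inj₂ refl)

  Edge-sym : ∀ t → Edge t u v → Edge t v u
  Edge-sym _ (u≢v , u∈ , v∈) = u≢v ∘ sym , v∈ , u∈

  Edge-≡ : t ≡ t′ → Edge t ⇒ Edge t′
  Edge-≡ refl = id

  Vtx⇒Edge : ∀ t → Vtx t x → ∃[ y ] Edge t x y
  Vtx⇒Edge t (inj₁ refl)        = T.b t , edge-ab t
  Vtx⇒Edge t (inj₂ (inj₁ refl)) = T.c t , edge-bc t
  Vtx⇒Edge t (inj₂ (inj₂ refl)) = T.a t , Edge-sym t (edge-ac t)

  Vtx? : ∀ t x → Dec (Vtx t x)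
  Vtx? t x = (x ≟ᶠ T.a t) ⊎-dec (x ≟ᶠ T.b t) ⊎-dec (x ≟ᶠ T.c t)

  Edge? : ∀ t → Decidable (Edge t)
  Edge? t u v = ¬? (u ≟ᶠ v) ×-dec Vtx? t u ×-dec Vtx? t v

  bac bca acb : Tri → Tri
  bac t = tri (T.b t) (T.a t) (T.c t) (adj-sym (T.ab t)) (T.ac t) (T.bc t)
  bca t = tri (T.b t) (T.c t) (T.a t) (T.bc t) (adj-sym (T.ac t)) (adj-sym (T.ab t))
  acb t = tri (T.a t) (T.c t) (T.b t) (T.ac t) (adj-sym (T.bc t)) (T.ab t)

  Edge-bac : ∀ t → Edge t ⇒ Edge (bac t)
  Edge-bac t (u≢v , u∈ , v∈) = u≢v , swap u∈ , swap v∈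
    where
    swap : Vtx t x → Vtx (bac t) x
    swap (inj₁ e)        = inj₂ (inj₁ e)
    swap (inj₂ (inj₁ e)) = inj₁ e
    swap (inj₂ (inj₂ e)) = inj₂ (inj₂ e)

  CycArc : Tri → Fin n → Fin n → Set
  CycArc t u v = (u ≡ T.a t × v ≡ T.b t) ⊎ (u ≡ T.b t × v ≡ T.c t) ⊎ (u ≡ T.c t × v ≡ T.a t)

  CycArc? : ∀ t → Decidable (CycArc t)
  CycArc? t u v = ((u ≟ᶠ T.a t) ×-dec (v ≟ᶠ T.b t))
           ⊎-dec ((u ≟ᶠ T.b t) ×-dec (v ≟ᶠ T.c t))
           ⊎-dec ((u ≟ᶠ T.c t) ×-dec (v ≟ᶠ T.a t))

  CycArc⇒Edge : ∀ t → CycArc t u v → Edge t u v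
  CycArc⇒Edge t (inj₁ (refl , refl))        = edge-ab t
  CycArc⇒Edge t (inj₂ (inj₁ (refl , refl))) = edge-bc t
  CycArc⇒Edge t (inj₂ (inj₂ (refl , refl))) = Edge-sym t (edge-ac t)

  CycArc⇒adj : ∀ t → CycArc t u v → adj u v ≡ true
  CycArc⇒adj t (inj₁ (refl , refl))        = T.ab t
  CycArc⇒adj t (inj₂ (inj₁ (refl , refl))) = T.bc t
  CycArc⇒adj t (inj₂ (inj₂ (refl , refl))) = adj-sym (T.ac t)

  Edge⇒CycArc : ∀ t → Edge t u v → CycArc t u v ⊎ CycArc t v u
  Edge⇒CycArc _ (u≢u , inj₁ refl , inj₁ refl)               = ⊥-elim (u≢u refl)
  Edge⇒CycArc _ (_ , inj₁ refl , inj₂ (inj₁ refl))          = inj₁ (inj₁ (refl , refl))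
  Edge⇒CycArc _ (_ , inj₁ refl , inj₂ (inj₂ refl))          = inj₂ (inj₂ (inj₂ (refl , refl)))
  Edge⇒CycArc _ (_ , inj₂ (inj₁ refl) , inj₁ refl)          = inj₂ (inj₁ (refl , refl))
  Edge⇒CycArc _ (u≢u , inj₂ (inj₁ refl) , inj₂ (inj₁ refl)) = ⊥-elim (u≢u refl)
  Edge⇒CycArc _ (_ , inj₂ (inj₁ refl) , inj₂ (inj₂ refl))   = inj₁ (inj₂ (inj₁ (refl , refl)))
  Edge⇒CycArc _ (_ , inj₂ (inj₂ refl) , inj₁ refl)          = inj₁ (inj₂ (inj₂ (refl , refl)))
  Edge⇒CycArc _ (_ , inj₂ (inj₂ refl) , inj₂ (inj₁ refl))   = inj₂ (inj₂ (inj₁ (refl , refl)))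
  Edge⇒CycArc _ (u≢u , inj₂ (inj₂ refl) , inj₂ (inj₂ refl)) = ⊥-elim (u≢u refl)

  CycArc-bac : ∀ t → CycArc t u v → CycArc (bac t) v u
  CycArc-bac _ (inj₁ (refl , refl))        = inj₁ (refl , refl)
  CycArc-bac _ (inj₂ (inj₁ (refl , refl))) = inj₂ (inj₂ (refl , refl))
  CycArc-bac _ (inj₂ (inj₂ (refl , refl))) = inj₂ (inj₁ (refl , refl))

  CycArc-asym : ∀ t → CycArc t u v → CycArc t v u → ⊥
  CycArc-asym t (inj₁ (refl , refl)) (inj₁ (e , _))               = a≢b t (sym e)
  CycArc-asym t (inj₁ (refl , refl)) (inj₂ (inj₁ (_ , e)))        = a≢c t e
  CycArc-asym t (inj₁ (refl , refl)) (inj₂ (inj₂ (e , _)))        = b≢c t e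
  CycArc-asym t (inj₂ (inj₁ (refl , refl))) (inj₁ (e , _))        = a≢c t (sym e)
  CycArc-asym t (inj₂ (inj₁ (refl , refl))) (inj₂ (inj₁ (_ , e))) = b≢c t e
  CycArc-asym t (inj₂ (inj₁ (refl , refl))) (inj₂ (inj₂ (_ , e))) = a≢b t (sym e)
  CycArc-asym t (inj₂ (inj₂ (refl , refl))) (inj₁ (_ , e))        = b≢c t (sym e)
  CycArc-asym t (inj₂ (inj₂ (refl , refl))) (inj₂ (inj₁ (e , _))) = a≢b t e
  CycArc-asym t (inj₂ (inj₂ (refl , refl))) (inj₂ (inj₂ (e , _))) = a≢c t e

  CycArc-close : ∀ t → CycArc t x y → CycArc t y z → CycArc t z x
  CycArc-close t (inj₁ (refl , refl)) (inj₁ (e , _))                  = ⊥-elim (a≢b t (sym e))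
  CycArc-close _ (inj₁ (refl , refl)) (inj₂ (inj₁ (_ , refl)))        = inj₂ (inj₂ (refl , refl))
  CycArc-close t (inj₁ (refl , refl)) (inj₂ (inj₂ (e , _)))           = ⊥-elim (b≢c t e)
  CycArc-close t (inj₂ (inj₁ (refl , refl))) (inj₁ (e , _))           = ⊥-elim (a≢c t (sym e))
  CycArc-close t (inj₂ (inj₁ (refl , refl))) (inj₂ (inj₁ (e , _)))    = ⊥-elim (b≢c t (sym e))
  CycArc-close _ (inj₂ (inj₁ (refl , refl))) (inj₂ (inj₂ (_ , refl))) = inj₁ (refl , refl)
  CycArc-close _ (inj₂ (inj₂ (refl , refl))) (inj₁ (_ , refl))        = inj₂ (inj₁ (refl , refl))
  CycArc-close t (inj₂ (inj₂ (refl , refl))) (inj₂ (inj₁ (e , _)))    = ⊥-elim (a≢b t e)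
  CycArc-close t (inj₂ (inj₂ (refl , refl))) (inj₂ (inj₂ (e , _)))    = ⊥-elim (a≢c t e)

  CycArc-out-unique : ∀ t → CycArc t x y → CycArc t x z → y ≡ z
  CycArc-out-unique _ (inj₁ (refl , refl)) (inj₁ (_ , refl))               = refl
  CycArc-out-unique t (inj₁ (refl , refl)) (inj₂ (inj₁ (e , _)))           = ⊥-elim (a≢b t e)
  CycArc-out-unique t (inj₁ (refl , refl)) (inj₂ (inj₂ (e , _)))           = ⊥-elim (a≢c t e)
  CycArc-out-unique t (inj₂ (inj₁ (refl , refl))) (inj₁ (e , _))           = ⊥-elim (a≢b t (sym e))
  CycArc-out-unique _ (inj₂ (inj₁ (refl , refl))) (inj₂ (inj₁ (_ , refl))) = refl
  CycArc-out-unique t (inj₂ (inj₁ (refl , refl))) (inj₂ (inj₂ (e , _)))    = ⊥-elim (b≢c t e)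
  CycArc-out-unique t (inj₂ (inj₂ (refl , refl))) (inj₁ (e , _))           = ⊥-elim (a≢c t (sym e))
  CycArc-out-unique t (inj₂ (inj₂ (refl , refl))) (inj₂ (inj₁ (e , _)))    = ⊥-elim (b≢c t (sym e))
  CycArc-out-unique _ (inj₂ (inj₂ (refl , refl))) (inj₂ (inj₂ (_ , refl))) = refl

  CycArc-in-unique : ∀ t → CycArc t x z → CycArc t y z → x ≡ y
  CycArc-in-unique t xz yz = CycArc-out-unique (bac t) (CycArc-bac t xz) (CycArc-bac t yz)

  Covered : List Tri → Fin n → Fin n → Set
  Covered L u v = Any (λ t → Edge t u v) L

  Arc : List Tri → Fin n → Fin n → Set
  Arc L u v = Any (λ t → CycArc t u v) L

  Covered? : ∀ L → Decidable (Covered L)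
  Covered? L u v = anyˡ? (λ t → Edge? t u v) L

  Arc? : ∀ L → Decidable (Arc L)
  Arc? L u v = anyˡ? (λ t → CycArc? t u v) L

  Covered-sym : Covered L u v → Covered L v u
  Covered-sym = mapᴬ λ {t} → Edge-sym t

  Covered⇒Vtx : Covered L u v → Any (λ t → Vtx t u) L
  Covered⇒Vtx = mapᴬ λ (_ , u∈ , _) → u∈

  Arc⇒Covered : Arc L u v → Covered L u v
  Arc⇒Covered = mapᴬ λ {t} → CycArc⇒Edge t

  Arc⇒adj : Arc L u v → adj u v ≡ true
  Arc⇒adj (here {t} uv) = CycArc⇒adj t uv
  Arc⇒adj (there uv)    = Arc⇒adj uv

  Covered⇒Arc : Covered L u v → Arc L u v ⊎ Arc L v u
  Covered⇒Arc (here {t} e) with Edge⇒CycArc t e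
  ... | inj₁ uv = inj₁ (here uv)
  ... | inj₂ vu = inj₂ (here vu)
  Covered⇒Arc (there c) with Covered⇒Arc c
  ... | inj₁ uv = inj₁ (there uv)
  ... | inj₂ vu = inj₂ (there vu)

  SharesEdge : Tri → (Fin n → Fin n → Set) → Set
  SharesEdge t C = ∃₂ λ u v → Edge t u v × C u v

  HasNewEdge : Tri → (Fin n → Fin n → Set) → Set
  HasNewEdge t C = ∃₂ λ u v → Edge t u v × ¬ C u v

  SharesEdge? : ∀ t {C} → Decidable C → Dec (SharesEdge t C)
  SharesEdge? t C? = any? λ u → any? λ v → Edge? t u v ×-dec C? u v

  HasNewEdge? : ∀ t {C} → Decidable C → Dec (HasNewEdge t C)
  HasNewEdge? t C? = any? λ u → any? λ v → Edge? t u v ×-dec ¬? (C? u v)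

  SharesEdge-mono : ∀ t t′ {C C′} → Edge t ⇒ Edge t′ → C ⇒ C′ →
                    SharesEdge t C → SharesEdge t′ C′
  SharesEdge-mono _ _ t⊆t′ C⊆C′ (u , v , e , c) = u , v , t⊆t′ e , C⊆C′ c

  HasNewEdge-mono : ∀ t t′ {C C′} → Edge t ⇒ Edge t′ → C′ ⇒ C →
                    HasNewEdge t C → HasNewEdge t′ C′
  HasNewEdge-mono _ _ t⊆t′ C′⊆C (u , v , e , ¬c) = u , v , t⊆t′ e , ¬c ∘ C′⊆C

  -- L is a union of K₃-components.
  EdgeClosed : List Tri → Set
  EdgeClosed L = ∀ Δ → SharesEdge Δ (Covered L) → Edge Δ ⇒ Covered L

  TwoEdgeClosed : List Tri → Set
  TwoEdgeClosed L = ∀ Δ → Covered L (T.b Δ) (T.c Δ) → Covered L (T.a Δ) (T.c Δ) →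
                        Covered L (T.a Δ) (T.b Δ)

  closure-bc : TwoEdgeClosed L → ∀ Δ →
               Covered L (T.a Δ) (T.b Δ) → Covered L (T.a Δ) (T.c Δ) → Covered L (T.b Δ) (T.c Δ)
  closure-bc closed Δ ab ac = closed (bca Δ) (Covered-sym ac) (Covered-sym ab)

  closure-ac : TwoEdgeClosed L → ∀ Δ →
               Covered L (T.a Δ) (T.b Δ) → Covered L (T.b Δ) (T.c Δ) → Covered L (T.a Δ) (T.c Δ)
  closure-ac closed Δ ab bc = closed (acb Δ) (Covered-sym bc) ab

  TwoEdgeClosed-++ : TwoEdgeClosed S → EdgeClosed B → TwoEdgeClosed (S ++ B)
  TwoEdgeClosed-++ {S} closedS closedB Δ bc ac with ++⁻ S bc | ++⁻ S ac
  ... | inj₂ bc∈B | _         = ++⁺ʳ S (closedB Δ (_ , _ , edge-bc Δ , bc∈B) (edge-ab Δ))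
  ... | inj₁ _    | inj₂ ac∈B = ++⁺ʳ S (closedB Δ (_ , _ , edge-ac Δ , ac∈B) (edge-ab Δ))
  ... | inj₁ bc∈S | inj₁ ac∈S = ++⁺ˡ (closedS Δ bc∈S ac∈S)

  ∃-triangle? : {P : Tri → Set} → (∀ t → Dec (P t)) → Dec (∃ P)
  ∃-triangle? {P} P? with any? (λ a → any? λ b → any? λ c →
                             Σ-≡true? (adj a b) λ ab → Σ-≡true? (adj b c) λ bc →
                             Σ-≡true? (adj a c) λ ac → P? (tri a b c ab bc ac))
  ... | yes (a , b , c , ab , bc , ac , p) = yes (tri a b c ab bc ac , p)
  ... | no ¬p = no λ (t , p) → ¬p (T.a t , T.b t , T.c t , T.ab t , T.bc t , T.ac t , p)

  uncovered : List Tri → List (Fin n × Fin n)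
  uncovered []      = cartesianProduct (allFin n) (allFin n)
  uncovered (t ∷ L) = filter (∁? (uncurry (Edge? t))) (uncovered L)

  uncovered-complete : ¬ Covered L x y → (x , y) ∈ uncovered L
  uncovered-complete {[]}    {x} {y} _ = ∈-cartesianProduct⁺ (∈-allFin x) (∈-allFin y)
  uncovered-complete {t ∷ L}        ¬c =
    ∈-filter⁺ (∁? (uncurry (Edge? t))) (uncovered-complete (¬c ∘ there)) (¬c ∘ here)

  uncovered-shrinks : HasNewEdge t (Covered L) → length (uncovered (t ∷ L)) < length (uncovered L)
  uncovered-shrinks {t} {L} (_ , _ , e , ¬c) =
    filter-notAll (∁? (uncurry (Edge? t))) (uncovered L) (lose (uncovered-complete ¬c) λ ¬e → ¬e e)

  -- A construction sequence H₁ ⊆ H₂ ⊆ … as the list of its copies, newest first.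
  data Construction : List Tri → Set where
    empty  : Construction []
    single : ∀ t → Construction (t ∷ [])
    grow   : SharesEdge t (Covered L) → HasNewEdge t (Covered L) → Construction L → Construction (t ∷ L)

  -- The copies of a newest-first list in chronological order, padded with d.
  timeline : Tri → List Tri → ℕ → Tri
  timeline d []      j = d
  timeline d (t ∷ L) j with j <? length L
  ... | yes _ = timeline d L j
  ... | no  _ = t

  timeline-old : ∀ d t L {j} → j < length L → timeline d (t ∷ L) j ≡ timeline d L j
  timeline-old d t L {j} j< with j <? length L
  ... | yes _  = refl
  ... | no j≮ = ⊥-elim (j≮ j<)

  timeline-new : ∀ d t L → timeline d (t ∷ L) (length L) ≡ t
  timeline-new d t L with length L <? length L
  ... | yes l<l = ⊥-elim (<-irrefl refl l<l)
  ... | no  _   = refl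

  timeline-++ : ∀ d R L {j} → j < length L → timeline d (R ++ L) j ≡ timeline d L j
  timeline-++ d []      L j< = refl
  timeline-++ d (r ∷ R) L j< = trans (timeline-old d r (R ++ L) j<′) (timeline-++ d R L j<)
    where
    j<′ = <-≤-trans j< (subst (length L ≤_) (sym (length-++ R)) (m≤n+m (length L) (length R)))

  Prefix : (Tri → Set) → (ℕ → Tri) → ℕ → Set
  Prefix Q 𝒯 i = ∃[ j ] (j ≤ i × Q (𝒯 j))

  Agree : (ℕ → Tri) → (ℕ → Tri) → ℕ → Set
  Agree 𝒯 𝒯′ i = ∀ j → j ≤ i → 𝒯 j ≡ 𝒯′ j

  Agree-sym : ∀ {𝒯 𝒯′ i} → Agree 𝒯 𝒯′ i → Agree 𝒯′ 𝒯 i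
  Agree-sym agree j j≤ = sym (agree j j≤)

  Prefix-cong : ∀ {Q 𝒯 𝒯′ i} → Agree 𝒯 𝒯′ i → Prefix Q 𝒯 i → Prefix Q 𝒯′ i
  Prefix-cong {Q} agree (j , j≤ , q) = j , j≤ , subst Q (agree j j≤) q

  PrefEdge-cong : ∀ {𝒯 𝒯′ i} → Agree 𝒯 𝒯′ i → PrefEdge G 𝒯 i ⇒ PrefEdge G 𝒯′ i
  PrefEdge-cong agree {u} {v} = Prefix-cong {λ s → Edge s u v} agree

  Any⇒Prefix : ∀ {Q} d t L → Any Q (t ∷ L) → Prefix Q (timeline d (t ∷ L)) (length L)
  Any⇒Prefix {Q} d t L (here q) = length L , ≤-refl , subst Q (sym (timeline-new d t L)) q
  Any⇒Prefix {Q} d t (p ∷ L) (there q∈) =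
    let (j , j≤ , q) = Any⇒Prefix d p L q∈
    in j , m≤n⇒m≤1+n j≤ , subst Q (sym (timeline-old d t (p ∷ L) (s≤s j≤))) q

  Prefix⇒Any : ∀ {Q} d t L → Prefix Q (timeline d (t ∷ L)) (length L) → Any Q (t ∷ L)
  Prefix⇒Any d t [] (zero , z≤n , q) = here q
  Prefix⇒Any {Q} d t (p ∷ L) (j , j≤ , q) with m≤n⇒m<n∨m≡n j≤
  ... | inj₁ j<   = there (Prefix⇒Any d p L (j , ≤-pred j< , subst Q (timeline-old d t (p ∷ L) j<) q))
  ... | inj₂ refl = here (subst Q (timeline-new d t (p ∷ L)) q)

  Covered⇒PrefEdge : ∀ {𝒯} d t L → Agree 𝒯 (timeline d (t ∷ L)) (length L) →
                     Covered (t ∷ L) ⇒ PrefEdge G 𝒯 (length L)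
  Covered⇒PrefEdge d t L agree {u} {v} = PrefEdge-cong (Agree-sym agree) ∘ Any⇒Prefix {λ s → Edge s u v} d t L

  PrefEdge⇒Covered : ∀ {𝒯} d t L → Agree 𝒯 (timeline d (t ∷ L)) (length L) →
                     PrefEdge G 𝒯 (length L) ⇒ Covered (t ∷ L)
  PrefEdge⇒Covered d t L agree {u} {v} = Prefix⇒Any {λ s → Edge s u v} d t L ∘ PrefEdge-cong agree

  ValidStep : (ℕ → Tri) → ℕ → Set
  ValidStep 𝒯 i = SharesEdge (𝒯 (suc i)) (PrefEdge G 𝒯 i) × HasNewEdge (𝒯 (suc i)) (PrefEdge G 𝒯 i)

  ValidStep-cong : ∀ {𝒯 𝒯′ i} → Agree 𝒯 𝒯′ (suc i) → ValidStep 𝒯 i → ValidStep 𝒯′ i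
  ValidStep-cong {𝒯} {𝒯′} {i} agree (sh , new) =
    SharesEdge-mono (𝒯 (suc i)) (𝒯′ (suc i)) newest (PrefEdge-cong agree′) sh ,
    HasNewEdge-mono (𝒯 (suc i)) (𝒯′ (suc i)) newest (PrefEdge-cong (Agree-sym agree′)) new
    where
    newest : Edge (𝒯 (suc i)) ⇒ Edge (𝒯′ (suc i))
    newest = Edge-≡ (agree (suc i) ≤-refl)
    agree′ : Agree 𝒯 𝒯′ i
    agree′ j j≤ = agree j (m≤n⇒m≤1+n j≤)

  timeline-step : ∀ d → Construction (t ∷ L) → ∀ {i} → i < length L → ValidStep (timeline d (t ∷ L)) i
  timeline-step d (grow {L = []} (_ , _ , _ , ()) _ _)
  timeline-step d (grow {t} {p ∷ L} sh new c) i< with m≤n⇒m<n∨m≡n i<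
  ... | inj₁ i+1< = ValidStep-cong (λ j j≤ → sym (timeline-old d t (p ∷ L) (≤-trans (s≤s j≤) i+1<)))
                                   (timeline-step d c (≤-pred i+1<))
  ... | inj₂ refl = SharesEdge-mono t newest t⊆ (Covered⇒PrefEdge d p L agree) sh ,
                    HasNewEdge-mono t newest t⊆ (PrefEdge⇒Covered d p L agree) new
    where
    newest = timeline d (t ∷ p ∷ L) (length (p ∷ L))
    t⊆ : Edge t ⇒ Edge newest
    t⊆ = Edge-≡ (sym (timeline-new d t (p ∷ L)))
    agree : Agree (timeline d (t ∷ p ∷ L)) (timeline d (p ∷ L)) (length L)
    agree j j≤ = timeline-old d t (p ∷ L) (s≤s j≤)

  SameCopy⇒Edge : SameCopy G t t′ → Edge t′ ⇒ Edge t
  SameCopy⇒Edge same {x} {y} (x≢y , x∈ , y∈) = x≢y , proj₂ (same x) x∈ , proj₂ (same y) y∈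

  ∈-component : ∀ d → Construction (t ∷ L) → t′ ∈ t ∷ L → SameComp G (timeline d (t ∷ L) 0) t′
  ∈-component d (single t) (here refl) = ε
  ∈-component d (grow {L = []} (_ , _ , _ , ()) _ _) _
  ∈-component d (grow {t} {p ∷ L} sh new c) t′∈ =
    subst (λ s → SameComp G s _) (sym (timeline-old d t (p ∷ L) (s≤s z≤n))) (from-older t′∈)
    where
    link : SharesEdge t (Covered (p ∷ L)) → HasNewEdge t (Covered (p ∷ L)) →
           SameComp G (timeline d (p ∷ L) 0) t
    link (u , v , e , uv∈) (x , y , e′ , ¬xy∈) =
      let (s , s∈ , e″) = find uv∈
          distinct = λ same → ¬xy∈ (lose s∈ (SameCopy⇒Edge {s} {t} same e′))
      in ∈-component d c s∈ ◅◅ (distinct , u , v , e″ , e) ◅ ε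
    from-older : t′ ∈ t ∷ p ∷ L → SameComp G (timeline d (p ∷ L) 0) t′
    from-older (here refl)  = link sh new
    from-older (there t′∈) = ∈-component d c t′∈

  component-covered : EdgeClosed L → Edge t ⇒ Covered L → SameComp G t t′ → Edge t′ ⇒ Covered L
  component-covered closed t⊆L ε                                     = t⊆L
  component-covered closed t⊆L (_◅_ {j = s} (_ , u , v , e , e′) path) =
    component-covered closed (closed s (u , v , e′ , t⊆L e)) path

  toConstructionSeq : ∀ d t L → Construction (t ∷ L) → EdgeClosed (t ∷ L) →
                      ConstructionSeq G (timeline d (t ∷ L) 0)
  toConstructionSeq d t L c closed = record
    { k      = length L
    ; T      = 𝒯
    ; start  = ε
    ; new    = λ i i< (_ , ⊆H) → let (u , v , e , ¬uv) = proj₂ (timeline-step d c i<) in ¬uv (⊆H u v e)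
    ; share  = λ i i< → proj₁ (timeline-step d c i<)
    ; finalV = λ x → in-component {λ s → Vtx s x} , vertex⇒prefix
    ; finalE = λ u v → in-component {λ s → Edge s u v} , edge⇒prefix
    }
    where
    𝒯 = timeline d (t ∷ L)
    in-component : ∀ {Q} → Prefix Q 𝒯 (length L) → ∃[ t′ ] (SameComp G (𝒯 0) t′ × Q t′)
    in-component {Q} p =
      let (t′ , t′∈ , q) = find (Prefix⇒Any {Q} d t L p) in t′ , ∈-component d c t′∈ , q
    covered : SameComp G (𝒯 0) t′ → Edge t′ ⇒ Covered (t ∷ L)
    covered = component-covered closed λ {u} {v} e → Prefix⇒Any {λ s → Edge s u v} d t L (0 , z≤n , e)
    edge⇒prefix : CompEdge G (𝒯 0) u v → PrefEdge G 𝒯 (length L) u v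
    edge⇒prefix {u} {v} (t′ , path , e) = Any⇒Prefix {λ s → Edge s u v} d t L (covered path e)
    vertex⇒prefix : CompVert G (𝒯 0) x → PrefVert G 𝒯 (length L) x
    vertex⇒prefix {x} (t′ , path , x∈) =
      let (y , e) = Vtx⇒Edge t′ x∈ in Any⇒Prefix {λ s → Vtx s x} d t L (Covered⇒Vtx (covered path e))

  saturated⇒EdgeClosed : ¬ (∃ λ t → SharesEdge t (Covered L) × HasNewEdge t (Covered L)) → EdgeClosed L
  saturated⇒EdgeClosed {L} none Δ sh {x} {y} e =
    decidable-stable (Covered? L x y) λ ¬xy → none (Δ , sh , x , y , e , ¬xy)

  complete : (f : ℕ) → Construction L → length (uncovered L) < f →
             ∃[ R ] (Construction (R ++ L) × EdgeClosed (R ++ L))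
  complete {L} (suc f) c bound
    with ∃-triangle? (λ t → SharesEdge? t (Covered? L) ×-dec HasNewEdge? t (Covered? L))
  ... | no none = [] , c , saturated⇒EdgeClosed none
  ... | yes (t , sh , new) =
    let (R , c′ , closed) = complete f (grow sh new c) (<-≤-trans (uncovered-shrinks {t} new) (≤-pred bound))
        assoc = sym (++-assoc R (t ∷ []) L)
    in R ++ t ∷ [] , subst Construction assoc c′ , subst EdgeClosed assoc closed

  third-edge : Covered L (T.b Δ) (T.c Δ) → Covered L (T.a Δ) (T.c Δ) → Edge Δ x y → ¬ Covered L x y →
               (x ≡ T.a Δ × y ≡ T.b Δ) ⊎ (x ≡ T.b Δ × y ≡ T.a Δ)
  third-edge {Δ = Δ} bc ac e ¬xy with Edge⇒CycArc Δ e
  ... | inj₁ (inj₁ (refl , refl))        = inj₁ (refl , refl)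
  ... | inj₁ (inj₂ (inj₁ (refl , refl))) = ⊥-elim (¬xy bc)
  ... | inj₁ (inj₂ (inj₂ (refl , refl))) = ⊥-elim (¬xy (Covered-sym ac))
  ... | inj₂ (inj₁ (refl , refl))        = inj₂ (refl , refl)
  ... | inj₂ (inj₂ (inj₁ (refl , refl))) = ⊥-elim (¬xy (Covered-sym bc))
  ... | inj₂ (inj₂ (inj₂ (refl , refl))) = ⊥-elim (¬xy ac)

  typeC-step : ∀ {s S} d R → ¬ Covered (s ∷ S) (T.a Δ) (T.b Δ) →
               Covered (s ∷ S) (T.b Δ) (T.c Δ) → Covered (s ∷ S) (T.a Δ) (T.c Δ) →
               let 𝒯 = timeline d (R ++ Δ ∷ s ∷ S) in StepC G 𝒯 (length S) (𝒯 (suc (length S)))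
  typeC-step {Δ} {s} {S} d R ¬ab bc ac =
    subst (StepC G 𝒯 (length S)) (sym newest)
      (vertices , T.a Δ , T.b Δ , edge-ab Δ , ¬ab ∘ from ,
       λ _ _ e ¬xy → third-edge {Δ = Δ} bc ac e (¬xy ∘ to))
    where
    𝒯 = timeline d (R ++ Δ ∷ s ∷ S)
    agree : Agree 𝒯 (timeline d (s ∷ S)) (length S)
    agree j j≤ = trans (timeline-++ d R (Δ ∷ s ∷ S) (s≤s (m≤n⇒m≤1+n j≤)))
                       (timeline-old d Δ (s ∷ S) (s≤s j≤))
    newest : 𝒯 (suc (length S)) ≡ Δ
    newest = trans (timeline-++ d R (Δ ∷ s ∷ S) ≤-refl) (timeline-new d Δ (s ∷ S))
    from : PrefEdge G 𝒯 (length S) ⇒ Covered (s ∷ S)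
    from = PrefEdge⇒Covered d s S agree
    to : Covered (s ∷ S) ⇒ PrefEdge G 𝒯 (length S)
    to = Covered⇒PrefEdge d s S agree
    covered : Vtx Δ x → Any (λ t → Vtx t x) (s ∷ S)
    covered (inj₁ refl)        = Covered⇒Vtx ac
    covered (inj₂ (inj₁ refl)) = Covered⇒Vtx bc
    covered (inj₂ (inj₂ refl)) = Covered⇒Vtx (Covered-sym bc)
    vertices : ∀ x → Vtx Δ x → PrefVert G 𝒯 (length S) x
    vertices x x∈ = Prefix-cong {λ t → Vtx t x} (Agree-sym agree) (Any⇒Prefix d s S (covered x∈))

  -- Otherwise Δ extends S by a step of type (C), and completing Δ ∷ S to a construction sequence
  -- of the whole K₃-component contradicts AB-constructibility.
  Construction⇒TwoEdgeClosed : ABConstructible G → Construction S → TwoEdgeClosed S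
  Construction⇒TwoEdgeClosed {[]}    ab c Δ () ac
  Construction⇒TwoEdgeClosed {s ∷ S} ab c Δ bc ac = decidable-stable (Covered? _ _ _) λ ¬ab →
    let (R , c′ , closed) = complete _ (grow (_ , _ , edge-bc Δ , bc) (_ , _ , edge-ab Δ , ¬ab) c) ≤-refl
        (t′ , L′ , eq , len) = ++-∷ R Δ (s ∷ S)
        typeC = subst (λ M → StepC G (timeline Δ M) (length S) (timeline Δ M (suc (length S)))) eq
                      (typeC-step Δ R ¬ab bc ac)
        seq = toConstructionSeq Δ t′ L′ (subst Construction eq c′) (subst EdgeClosed eq closed)
    in ab _ seq (length S) len typeC

  Consistent : List Tri → Set
  Consistent L = ∀ {u v} → Arc L u v → Arc L v u → ⊥

  TT₃-free : List Tri → Set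
  TT₃-free L = ∀ {u v w} → Arc L u v → Arc L v w → Arc L u w → ⊥

  Opposed : List Tri → Tri → Set
  Opposed L t = ∃₂ λ x y → Arc L x y × CycArc t y x

  Opposed? : ∀ L t → Dec (Opposed L t)
  Opposed? L t = any? λ x → any? λ y → Arc? L x y ×-dec CycArc? t y x

  Consistent-∷ : ¬ Opposed L t → Consistent L → Consistent (t ∷ L)
  Consistent-∷ {t = t} _    _    (here xy)  (here yx)  = CycArc-asym t xy yx
  Consistent-∷         ¬opp _    (here xy)  (there yx) = ¬opp (_ , _ , yx , xy)
  Consistent-∷         ¬opp _    (there xy) (here yx)  = ¬opp (_ , _ , xy , yx)
  Consistent-∷         _    cons (there xy) (there yx) = cons xy yx

  Consistent⇒Arc : Consistent (t ∷ L) → CycArc t x y → Covered L x y → Arc L x y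
  Consistent⇒Arc cons xy∈t xy∈L with Covered⇒Arc xy∈L
  ... | inj₁ xy = xy
  ... | inj₂ yx = ⊥-elim (cons (here xy∈t) (there yx))

  arcs⇒triangle : Arc L u v → Arc L v w → Arc L u w → Tri
  arcs⇒triangle {u = u} {v} {w} uv vw uw = tri u v w (Arc⇒adj uv) (Arc⇒adj vw) (Arc⇒adj uw)

  TT₃-free-∷ : TwoEdgeClosed L → Consistent (t ∷ L) → TT₃-free L → TT₃-free (t ∷ L)
  TT₃-free-∷ {t = t} _ _ _ (here uv) (here vw) (here uw) = CycArc-asym t (CycArc-close t uv vw) uw
  TT₃-free-∷ {t = t} _ cons _ (here uv) (here vw) (there uw) = cons (here (CycArc-close t uv vw)) (there uw)
  TT₃-free-∷ {t = t} _ _ _ (here uv) (there vw) (here uw) = adj⇒≢ (Arc⇒adj vw) (CycArc-out-unique t uv uw)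
  TT₃-free-∷ {t = t} _ _ _ (there uv) (here vw) (here uw) = adj⇒≢ (Arc⇒adj uv) (CycArc-in-unique t uw vw)
  TT₃-free-∷ closed cons free A₁@(here uv) A₂@(there vw) A₃@(there uw) =
    free (Consistent⇒Arc cons uv (closed uvw (Arc⇒Covered vw) (Arc⇒Covered uw))) vw uw
    where uvw = arcs⇒triangle A₁ A₂ A₃
  TT₃-free-∷ closed cons free A₁@(there uv) A₂@(here vw) A₃@(there uw) =
    free uv (Consistent⇒Arc cons vw (closure-bc closed uvw (Arc⇒Covered uv) (Arc⇒Covered uw))) uw
    where uvw = arcs⇒triangle A₁ A₂ A₃
  TT₃-free-∷ closed cons free A₁@(there uv) A₂@(there vw) A₃@(here uw) =
    free uv vw (Consistent⇒Arc cons uw (closure-ac closed uvw (Arc⇒Covered uv) (Arc⇒Covered vw)))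
    where uvw = arcs⇒triangle A₁ A₂ A₃
  TT₃-free-∷ _ _ free (there uv) (there vw) (there uw) = free uv vw uw

  all-covered : ∀ t → Covered L (T.a t) (T.b t) → Covered L (T.b t) (T.c t) → Covered L (T.a t) (T.c t) →
                Edge t ⇒ Covered L
  all-covered {L} t ab bc ac e = [ covered , Covered-sym ∘ covered ]′ (Edge⇒CycArc t e)
    where
    covered : CycArc t x y → Covered L x y
    covered (inj₁ (refl , refl))        = ab
    covered (inj₂ (inj₁ (refl , refl))) = bc
    covered (inj₂ (inj₂ (refl , refl))) = Covered-sym ac

  covered-arcs-coincide : TwoEdgeClosed L → HasNewEdge t (Covered L) →
                          CycArc t x y → CycArc t u v → Covered L x y → Covered L u v → x ≡ u
  covered-arcs-coincide {L} {t} closed (_ , _ , e , ¬new) = coincide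
    where
    ¬all : Covered L (T.a t) (T.b t) → Covered L (T.b t) (T.c t) → Covered L (T.a t) (T.c t) → ⊥
    ¬all ab bc ac = ¬new (all-covered t ab bc ac e)
    ¬ab∧bc : Covered L (T.a t) (T.b t) → Covered L (T.b t) (T.c t) → ⊥
    ¬ab∧bc ab bc = ¬all ab bc (closure-ac closed t ab bc)
    ¬ab∧ac : Covered L (T.a t) (T.b t) → Covered L (T.a t) (T.c t) → ⊥
    ¬ab∧ac ab ac = ¬all ab (closure-bc closed t ab ac) ac
    ¬bc∧ac : Covered L (T.b t) (T.c t) → Covered L (T.a t) (T.c t) → ⊥
    ¬bc∧ac bc ac = ¬all (closed t bc ac) bc ac
    coincide : CycArc t x y → CycArc t u v → Covered L x y → Covered L u v → x ≡ u
    coincide (inj₁ (refl , refl))        (inj₁ (refl , refl))        _  _  = refl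
    coincide (inj₁ (refl , refl))        (inj₂ (inj₁ (refl , refl))) ab bc = ⊥-elim (¬ab∧bc ab bc)
    coincide (inj₁ (refl , refl))        (inj₂ (inj₂ (refl , refl))) ab ca = ⊥-elim (¬ab∧ac ab (Covered-sym ca))
    coincide (inj₂ (inj₁ (refl , refl))) (inj₁ (refl , refl))        bc ab = ⊥-elim (¬ab∧bc ab bc)
    coincide (inj₂ (inj₁ (refl , refl))) (inj₂ (inj₁ (refl , refl))) _  _  = refl
    coincide (inj₂ (inj₁ (refl , refl))) (inj₂ (inj₂ (refl , refl))) bc ca = ⊥-elim (¬bc∧ac bc (Covered-sym ca))
    coincide (inj₂ (inj₂ (refl , refl))) (inj₁ (refl , refl))        ca ab = ⊥-elim (¬ab∧ac ab (Covered-sym ca))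
    coincide (inj₂ (inj₂ (refl , refl))) (inj₂ (inj₁ (refl , refl))) ca bc = ⊥-elim (¬bc∧ac bc (Covered-sym ca))
    coincide (inj₂ (inj₂ (refl , refl))) (inj₂ (inj₂ (refl , refl))) _  _  = refl

  ¬Opposed-bac : TwoEdgeClosed L → HasNewEdge t (Covered L) → Consistent L →
                 Opposed L t → ¬ Opposed L (bac t)
  ¬Opposed-bac {t = t} closed new cons (x , y , xy , yx∈t) (u , v , uv , vu∈bac)
    with uv∈t ← CycArc-bac (bac t) vu∈bac
    with covered-arcs-coincide {t = t} closed new yx∈t uv∈t
           (Covered-sym (Arc⇒Covered xy)) (Arc⇒Covered uv)
  ... | refl with CycArc-out-unique t yx∈t uv∈t
  ... | refl = cons xy uv

  orient-unopposed : TwoEdgeClosed L → Consistent L → TT₃-free L → ¬ Opposed L t →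
                     Consistent (t ∷ L) × TT₃-free (t ∷ L)
  orient-unopposed closed cons free ¬opp = cons′ , TT₃-free-∷ closed cons′ free
    where
    cons′ = Consistent-∷ ¬opp cons

  orient : TwoEdgeClosed L → Consistent L → TT₃-free L → HasNewEdge t (Covered L) →
           ∃[ t′ ] (Edge t ⇒ Edge t′ × Consistent (t′ ∷ L) × TT₃-free (t′ ∷ L))
  orient {L} {t} closed cons free new with Opposed? L t
  ... | no ¬opp = t , id , orient-unopposed closed cons free ¬opp
  ... | yes opp = bac t , Edge-bac t ,
                  orient-unopposed closed cons free (¬Opposed-bac {t = t} closed new cons opp)

  EdgeClosed-++ : EdgeClosed B →
                  ¬ (∃ λ t → SharesEdge t (Covered S) × HasNewEdge t (Covered (S ++ B))) →
                  EdgeClosed (S ++ B)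
  EdgeClosed-++ {B} {S} closedB none = saturated⇒EdgeClosed candidate
    where
    candidate : ∃ (λ t → SharesEdge t (Covered (S ++ B)) × HasNewEdge t (Covered (S ++ B))) → ⊥
    candidate (t , (u , v , e , uv∈) , new@(_ , _ , e′ , ¬new)) with ++⁻ S uv∈
    ... | inj₁ uv∈S = none (t , (u , v , e , uv∈S) , new)
    ... | inj₂ uv∈B = ¬new (++⁺ʳ S (closedB t (u , v , e , uv∈B) e′))

  record Covering : Set where
    field
      arcs       : List Tri
      consistent : Consistent arcs
      tt-free    : TT₃-free arcs
      covers     : ∀ Δ → Edge Δ ⇒ Covered arcs

  -- S is the construction in progress, B the union of the K₃-components already oriented.
  orient-all : ABConstructible G → (f : ℕ) → Construction S → EdgeClosed B →
               Consistent (S ++ B) → TT₃-free (S ++ B) → length (uncovered (S ++ B)) < f → Covering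
  orient-all {S} {B} ab (suc f) c closedB cons free bound
    with ∃-triangle? (λ t → SharesEdge? t (Covered? S) ×-dec HasNewEdge? t (Covered? (S ++ B)))
  ... | yes (t , sh , new) =
    let closed = TwoEdgeClosed-++ (Construction⇒TwoEdgeClosed ab c) closedB
        (t′ , t⊆t′ , cons′ , free′) = orient {t = t} closed cons free new
        new′ = HasNewEdge-mono t t′ t⊆t′ id new
    in orient-all ab f (grow (SharesEdge-mono t t′ t⊆t′ id sh) (HasNewEdge-mono t t′ t⊆t′ ++⁺ˡ new) c)
                  closedB cons′ free′ (<-≤-trans (uncovered-shrinks {t′} new′) (≤-pred bound))
  ... | no none with ∃-triangle? (λ t → HasNewEdge? t (Covered? (S ++ B)))
  ...   | yes (t , new) =
    let closed = TwoEdgeClosed-++ (Construction⇒TwoEdgeClosed ab c) closedB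
        (t′ , t⊆t′ , cons′ , free′) = orient {t = t} closed cons free new
        new′ = HasNewEdge-mono t t′ t⊆t′ id new
    in orient-all ab f (single t′) (EdgeClosed-++ closedB none) cons′ free′
                  (<-≤-trans (uncovered-shrinks {t′} new′) (≤-pred bound))
  ...   | no saturated = record
    { arcs       = S ++ B
    ; consistent = cons
    ; tt-free    = free
    ; covers     = λ Δ {x} {y} e →
                     decidable-stable (Covered? (S ++ B) x y) λ ¬xy → saturated (Δ , x , y , e , ¬xy)
    }

  covering : ABConstructible G → Covering
  covering ab = orient-all {B = []} ab _ empty (λ { _ (_ , _ , _ , ()) }) (λ ()) (λ ()) ≤-refl

  module _ (C : Covering) where
    open Covering C

    Dir : Fin n → Fin n → Set
    Dir u v = Arc arcs u v ⊎ (¬ Covered arcs u v × u <ᶠ v)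

    Dir? : Decidable Dir
    Dir? u v = Arc? arcs u v ⊎-dec (¬? (Covered? arcs u v) ×-dec (u <ᶠ? v))

    Dir-asym : Dir u v → Dir v u → ⊥
    Dir-asym (inj₁ uv)        (inj₁ vu)        = consistent uv vu
    Dir-asym (inj₁ uv)        (inj₂ (¬vu , _)) = ¬vu (Covered-sym (Arc⇒Covered uv))
    Dir-asym (inj₂ (¬uv , _)) (inj₁ vu)        = ¬uv (Covered-sym (Arc⇒Covered vu))
    Dir-asym (inj₂ (_ , u<v)) (inj₂ (_ , v<u)) = <ᶠ-asym u<v v<u

    Dir-total : u ≢ v → Dir u v ⊎ Dir v u
    Dir-total {u} {v} u≢v with Covered? arcs u v
    ... | yes uv∈ = Sum.map inj₁ inj₁ (Covered⇒Arc uv∈)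
    ... | no ¬uv∈ with <-cmp u v
    ...   | tri< u<v _   _   = inj₁ (inj₂ (¬uv∈ , u<v))
    ...   | tri≈ _   u≡v _   = ⊥-elim (u≢v u≡v)
    ...   | tri> _   _   v<u = inj₂ (inj₂ (¬uv∈ ∘ Covered-sym , v<u))

    Dir⇒Arc : Covered arcs u v → Dir u v → Arc arcs u v
    Dir⇒Arc _   (inj₁ uv)       = uv
    Dir⇒Arc uv∈ (inj₂ (¬uv , _)) = ⊥-elim (¬uv uv∈)

    Arrow : Fin n → Fin n → Set
    Arrow u v = adj u v ≡ true × Dir u v

    Arrow? : Decidable Arrow
    Arrow? u v = (adj u v ≟ᵇ true) ×-dec Dir? u v

    orientation : Orientation G
    orientation = record
      { arc     = λ u v → does (Arrow? u v)
      ; arc-adj = λ u v → proj₁ ∘ does-true (Arrow? u v)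
      ; arc-one = λ u v uv → does-xor (Arrow? u v) (Arrow? v u) (λ (_ , d) (_ , d′) → Dir-asym d d′)
                               (Sum.map (uv ,_) (adj-sym uv ,_) (Dir-total (adj⇒≢ uv)))
      }

    orientation-TT₃-free : ¬ HasTT₃ G orientation
    orientation-TT₃-free (a , b , c , ab , bc , ac) =
      let (adj-ab , dir-ab) = does-true (Arrow? a b) ab
          (adj-bc , dir-bc) = does-true (Arrow? b c) bc
          (adj-ac , dir-ac) = does-true (Arrow? a c) ac
          Δ = tri a b c adj-ab adj-bc adj-ac
      in tt-free (Dir⇒Arc (covers Δ (edge-ab Δ)) dir-ab)
                 (Dir⇒Arc (covers Δ (edge-bc Δ)) dir-bc)
                 (Dir⇒Arc (covers Δ (edge-ac Δ)) dir-ac)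

proposition10 : ∀ (n : ℕ) (H : Graph n) → ABConstructible H → NotArrowTT₃ H
proposition10 n H ab = orientation H (covering H ab) , orientation-TT₃-free H (covering H ab)
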